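{- Let $k \geq 1$ and $u \geq 0$ be integers, and let $G$ be a $2$-edge-coloring of the complete graph $K_{4k+u}$ with colors red and blue. Suppose that $G$ contains at most $k$ pairwise vertex-disjoint blue copies of $K_4$. Then $G$ contains at least $f_k(u)$ pairwise vertex-disjoint red copies of $K_2$ (i.e., a red matching of size at least $f_k(u)$), where $$f_k(u) = \begin{cases} 0, & u \leq 3,\\ u-3, & 4 \leq u \leq k+3,\\ \left\lfloor \frac{u+k-2}{2}\right\rfloor, & u \geq k+4.\end{cases}$$
   Context: A blue (resp. red) copy of a graph $H$ is a subgraph isomorphic to $H$ all of whose edges are blue (resp. red). -}

module Defs where

open import Data.Nat using (ℕ; _+_; _*_; _∸_; _≤_; _≤?_; _/_)
open import Data.Fin using (Fin)
open import Data.Product using (_×_; uncurry)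
open import Function.Definitions using (Injective)
open import Relation.Binary.PropositionalEquality using (_≡_)
open import Relation.Nullary using (yes; no; ¬_)

data Colour : Set where
  red blue : Colour

-- A 2-edge-colouring of K_n: colour of each unordered pair {x,y}, x ≠ y.
-- Represented as a symmetric function on ordered pairs (diagonal ignored).
record Colouring (n : ℕ) : Set where
  field
    col : Fin n → Fin n → Colour
    sym : ∀ x y → col x y ≡ col y x
open Colouring public

MonoCopy : ∀ {n} → Colouring n → Colour → (r : ℕ) → (Fin r → Fin n) → Set
MonoCopy G c r v = Injective _≡_ _≡_ v × (∀ i j → ¬ i ≡ j → col G (v i) (v j) ≡ c)

-- m pairwise vertex-disjoint copies of K_r in colour c: a family
-- Fin m → (Fin r → Fin n), each a monochromatic copy, and jointly injective
-- (so distinct copies share no vertex).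
DisjointCopies : ∀ {n} → Colouring n → Colour → (r m : ℕ) → Set
DisjointCopies {n} G c r m =
  Σ′ (Fin m → Fin r → Fin n) λ F →
    (∀ a → MonoCopy G c r (F a)) × Injective _≡_ _≡_ (uncurry F)
  where
    open import Data.Product using () renaming (Σ to Σ′)

f : ℕ → ℕ → ℕ
f k u with u ≤? 3
... | yes _ = 0
... | no _ with u ≤? k + 3
...   | yes _ = u ∸ 3
...   | no _ = (u + k ∸ 2) / 2

-- We show more generally: a set P of vertices with |P| + 1 ≥ max(2a + 3b, a + 4b)
-- contains a red matching of size a or b disjoint blue K₄'s, by induction on a.
-- If P has no red edge it is a blue clique, which we cut into K₄'s. Otherwise pick
-- a red edge xy and apply the statement with b = 1 to P − {x, y}: this either
-- completes the matching or yields a blue K₄ Q avoiding x and y. If x sends a red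
-- edge into Q, then {x} ∪ Q, and otherwise {x, y} ∪ (Q − q₁) (where {x} ∪ (Q − q₁)
-- is a blue K₄), is a set of five vertices carrying both a blue K₄ and a red edge.
-- Removing these five vertices and recursing gains one red edge and one blue K₄.
-- For the theorem, take P all 4k + u vertices, a = f_k(u) and b = k + 1.
module Submission where

open import Defs
open import Data.Nat using (ℕ; zero; suc; _+_; _*_; _∸_; _≤_; _<_; _≥_; _≤?_; _/_; s≤s)
open import Data.Nat.Properties
  using (≤-trans; ≤-pred; +-comm; *-comm; m≤m+n; m+n≤o⇒m≤o; m+n≤o⇒n≤o; +-cancelˡ-≤; +-monoˡ-≤;
         *-cancelʳ-≤; ≰⇒>; m≤n⇒∃[o]m+o≡n; 1+n≰n)
open import Data.Nat.DivMod using (m/n*n≤m)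
open import Data.Nat.Tactic.RingSolver using (solve-∀)
open import Data.Fin using (Fin; zero; suc; _≟_)
open import Data.List using (List; []; _∷_; _++_; length; lookup; tabulate; allFin)
open import Data.List.Properties using (length-++; length-tabulate)
open import Data.List.Relation.Unary.All as All using (All; []; _∷_)
open import Data.List.Relation.Unary.All.Properties using (¬All⇒Any¬) renaming (tabulate⁺ to All-tabulate⁺)
open import Data.List.Relation.Unary.AllPairs as AllPairs using (AllPairs; []; _∷_)
open import Data.List.Relation.Unary.AllPairs.Properties using (take⁺; drop⁺; tabulate⁺)
open import Data.List.Relation.Unary.Unique.Propositional using (Unique)
open import Data.List.Relation.Unary.Unique.Propositional.Properties using (allFin⁺)
open import Data.List.Membership.Propositional using (_∈_; find)
open import Data.List.Membership.Propositional.Properties using (∈-lookup; ∈-∃++; ∈-++⁺ˡ; ∈-++⁺ʳ)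
open import Data.List.Relation.Unary.Any using (here; there)
open import Data.List.Relation.Binary.Permutation.Propositional using (_↭_; ↭-refl; ↭-sym; ↭-trans; ↭-prep; ↭⇒↭ₛ)
open import Data.List.Relation.Binary.Permutation.Propositional.Properties using (∈-resp-↭; ↭-length; shift)
import Data.List.Relation.Binary.Permutation.Setoid.Properties as Permutationₛ
open import Data.Vec.Functional using () renaming (_∷_ to _∷ᶠ_)
open import Data.Product using (Σ; ∃; ∃₂; _×_; _,_; proj₁; proj₂)
open import Data.Sum as Sum using (_⊎_; inj₁; inj₂)
open import Data.Empty using (⊥-elim)
open import Function using (_∘_; id)
open import Relation.Binary.Definitions using (Symmetric)
open import Relation.Binary.PropositionalEquality as ≡ using (_≡_; _≢_; refl; cong; subst)
open import Relation.Nullary using (Dec; yes; no)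

module _ {a} {A : Set a} where

  AllPairs-lookup : ∀ {ℓ} {R : A → A → Set ℓ} {xs : List A} → Symmetric R → AllPairs R xs →
                    ∀ {i j} → i ≢ j → R (lookup xs i) (lookup xs j)
  AllPairs-lookup R-sym (_ ∷ _) {zero} {zero} i≢j = ⊥-elim (i≢j refl)
  AllPairs-lookup R-sym (hd ∷ _) {zero} {suc j} _ = All.lookup hd (∈-lookup j)
  AllPairs-lookup R-sym (hd ∷ _) {suc i} {zero} _ = R-sym (All.lookup hd (∈-lookup i))
  AllPairs-lookup R-sym (_ ∷ tl) {suc i} {suc j} i≢j = AllPairs-lookup R-sym tl (i≢j ∘ cong suc)

  Unique-↭ : ∀ {xs ys : List A} → xs ↭ ys → Unique xs → Unique ys
  Unique-↭ = Permutationₛ.Unique-resp-↭ (≡.setoid A) ∘ ↭⇒↭ₛ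

  Unique-++⁻ʳ : ∀ (xs : List A) {ys} → Unique (xs ++ ys) → Unique ys
  Unique-++⁻ʳ [] u = u
  Unique-++⁻ʳ (_ ∷ xs) (_ ∷ u) = Unique-++⁻ʳ xs u

  Unique-++-disjoint : ∀ {xs ys : List A} {x y} → Unique (xs ++ ys) → x ∈ xs → y ∈ ys → x ≢ y
  Unique-++-disjoint {_ ∷ xs} (hd ∷ _) (here refl) y∈ys = All.lookup hd (∈-++⁺ʳ xs y∈ys)
  Unique-++-disjoint (_ ∷ u) (there x∈xs) y∈ys = Unique-++-disjoint u x∈xs y∈ys

  ∈-shift⁻ : ∀ {x y : A} hs ts → y ∈ hs ++ x ∷ ts → x ≢ y → y ∈ hs ++ ts
  ∈-shift⁻ {x} hs ts y∈ x≢y with ∈-resp-↭ (shift x hs ts) y∈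
  ... | here y≡x = ⊥-elim (x≢y (≡.sym y≡x))
  ... | there y∈hs++ts = y∈hs++ts

  ↭-complement : ∀ {xs ys : List A} → Unique xs → All (_∈ ys) xs → ∃ λ zs → ys ↭ xs ++ zs
  ↭-complement [] [] = _ , ↭-refl
  ↭-complement {x ∷ _} (x∉xs ∷ u) (x∈ys ∷ xs⊆ys) with hs , ts , refl ← ∈-∃++ x∈ys =
    let zs , p = ↭-complement u (All.zipWith (λ (x≢y , y∈) → ∈-shift⁻ hs ts y∈ x≢y) (x∉xs , xs⊆ys))
    in zs , ↭-trans (shift x hs ts) (↭-prep x p)

  complement-Unique : ∀ {P S P' : List A} → Unique P → P ↭ S ++ P' → Unique P'
  complement-Unique {S = S} uP P↭ = Unique-++⁻ʳ S (Unique-↭ P↭ uP)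

  complement-length : ∀ {P S P' : List A} → P ↭ S ++ P' → length P ≡ length S + length P'
  complement-length {S = S} P↭ = ≡.trans (↭-length P↭) (length-++ S)

Large : ℕ → ℕ → ℕ → Set
Large a b N = 2 * a + 3 * b ≤ suc N × a + 4 * b ≤ suc N

Large⇒K₄-room : ∀ {a b N} → Large (suc a) b N → b * 4 ≤ N
Large⇒K₄-room {a} {b} {N} (_ , h) = subst (_≤ N) (*-comm 4 b) (m+n≤o⇒n≤o a (≤-pred h))

Large⇒matching-room : ∀ {a b N} → Large (suc a) (suc b) (2 + N) → 2 * a + 3 ≤ suc N
Large⇒matching-room {a} {b} {N} (h , _) =
  +-cancelˡ-≤ 2 _ _ (m+n≤o⇒m≤o (2 + (2 * a + 3)) (subst (_≤ 3 + N) (regroup a b) h))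
  where
  regroup : ∀ a b → 2 * suc a + 3 * suc b ≡ 2 + (2 * a + 3) + 3 * b
  regroup = solve-∀

matching-room⇒Large : ∀ {a N} → 2 * suc a + 3 ≤ suc N → Large (suc a) 1 N
matching-room⇒Large {a} h = h , ≤-trans (subst (suc a + 4 * 1 ≤_) (slack a) (m≤m+n (suc a + 4 * 1) a)) h
  where
  slack : ∀ a → suc a + 4 * 1 + a ≡ 2 * suc a + 3
  slack = solve-∀

Large-shrink : ∀ {a b N} → Large (suc a) (suc b) (5 + N) → Large a b N
Large-shrink {a} {b} {N} (h₁ , h₂) =
    +-cancelˡ-≤ 5 _ _ (subst (_≤ 6 + N) (regroup₁ a b) h₁)
  , +-cancelˡ-≤ 5 _ _ (subst (_≤ 6 + N) (regroup₂ a b) h₂)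
  where
  regroup₁ : ∀ a b → 2 * suc a + 3 * suc b ≡ 5 + (2 * a + 3 * b)
  regroup₁ = solve-∀
  regroup₂ : ∀ a b → suc a + 4 * suc b ≡ 5 + (a + 4 * b)
  regroup₂ = solve-∀

blue? : (c : Colour) → Dec (c ≡ blue)
blue? red = no λ ()
blue? blue = yes refl

≢blue⇒≡red : ∀ {c} → c ≢ blue → c ≡ red
≢blue⇒≡red {red} _ = refl
≢blue⇒≡red {blue} c≢blue = ⊥-elim (c≢blue refl)

module _ {n : ℕ} (G : Colouring n) where

  Mono : Colour → Fin n → Fin n → Set
  Mono c x y = x ≢ y × col G x y ≡ c

  MonoClique : Colour → List (Fin n) → Set
  MonoClique c = AllPairs (Mono c)

  Mono-sym : ∀ {c} → Symmetric (Mono c)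
  Mono-sym {x = x} {y} (x≢y , xy) = x≢y ∘ ≡.sym , ≡.trans (sym G y x) xy

  Mono⇒MonoClique : ∀ {c x y} → Mono c x y → MonoClique c (x ∷ y ∷ [])
  Mono⇒MonoClique xy = (xy ∷ []) ∷ [] ∷ []

  MonoClique⇒Unique : ∀ {c xs} → MonoClique c xs → Unique xs
  MonoClique⇒Unique = AllPairs.map proj₁

  MonoClique⇒MonoCopy : ∀ {c xs} → MonoClique c xs → MonoCopy G c (length xs) (lookup xs)
  MonoClique⇒MonoCopy {c} {xs} clique = injective , λ _ _ → proj₂ ∘ lookup-mono
    where
    lookup-mono : ∀ {i j} → i ≢ j → Mono c (lookup xs i) (lookup xs j)
    lookup-mono = AllPairs-lookup Mono-sym clique
    injective : ∀ {i j} → lookup xs i ≡ lookup xs j → i ≡ j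
    injective {i} {j} eq with i ≟ j
    ... | yes i≡j = i≡j
    ... | no i≢j = ⊥-elim (proj₁ (lookup-mono i≢j) eq)

  MonoCopy⇒MonoClique : ∀ {c r v} → MonoCopy G c r v → MonoClique c (tabulate v)
  MonoCopy⇒MonoClique (injective , mono) = tabulate⁺ λ {i} {j} i≢j → i≢j ∘ injective , mono i j i≢j

  blue-or-red-edge : ∀ x ys → All (λ y → col G x y ≡ blue) ys ⊎ ∃ λ y → y ∈ ys × col G x y ≡ red
  blue-or-red-edge x ys with All.all? (λ y → blue? (col G x y)) ys
  ... | yes all-blue = inj₁ all-blue
  ... | no ¬all-blue with y , y∈ys , xy≢blue ← find (¬All⇒Any¬ (λ y → blue? (col G x y)) ys ¬all-blue) =
    inj₂ (y , y∈ys , ≢blue⇒≡red xy≢blue)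

  RedEdgeIn : List (Fin n) → Set
  RedEdgeIn P = ∃₂ λ x y → x ∈ P × y ∈ P × Mono red x y

  red-edge-or-blue-clique : ∀ P → Unique P → RedEdgeIn P ⊎ MonoClique blue P
  red-edge-or-blue-clique [] [] = inj₂ []
  red-edge-or-blue-clique (x ∷ P) (x∉P ∷ uP) with blue-or-red-edge x P
  ... | inj₂ (y , y∈P , xy) = inj₁ (x , y , here refl , there y∈P , All.lookup x∉P y∈P , xy)
  ... | inj₁ all-blue with red-edge-or-blue-clique P uP
  ...   | inj₁ (y , z , y∈P , z∈P , yz) = inj₁ (y , z , there y∈P , there z∈P , yz)
  ...   | inj₂ P-blue = inj₂ (All.zip (x∉P , all-blue) ∷ P-blue)

  Packing : Colour → (r m : ℕ) → List (Fin n) → Set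
  Packing c r m P = Σ (DisjointCopies G c r m) λ (F , _) → ∀ a j → F a j ∈ P

  Packing-[] : ∀ {c r P} → Packing c r 0 P
  Packing-[] = ((λ ()) , (λ ()) , λ { {() , _} }) , λ ()

  Packing-∷ : ∀ {c r m P S P' v} → Unique P → P ↭ S ++ P' → MonoCopy G c r v → (∀ j → v j ∈ S) →
              Packing c r m P' → Packing c r (suc m) P
  Packing-∷ {c} {r} {m} {P} {S} {P'} {v} uP P↭ v-copy v⊆S ((F , copies , injective) , F⊆P') =
    (v ∷ᶠ F , copies′ , injective′) , F′⊆P
    where
    S∩P'=∅ : ∀ {x y} → x ∈ S → y ∈ P' → x ≢ y
    S∩P'=∅ = Unique-++-disjoint (Unique-↭ P↭ uP)
    copies′ : ∀ a → MonoCopy G c r ((v ∷ᶠ F) a)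
    copies′ zero = v-copy
    copies′ (suc a) = copies a
    injective′ : ∀ {p q} → (v ∷ᶠ F) (proj₁ p) (proj₂ p) ≡ (v ∷ᶠ F) (proj₁ q) (proj₂ q) → p ≡ q
    injective′ {zero , i} {zero , j} eq = cong (zero ,_) (proj₁ v-copy eq)
    injective′ {zero , i} {suc b , j} eq = ⊥-elim (S∩P'=∅ (v⊆S i) (F⊆P' b j) eq)
    injective′ {suc a , i} {zero , j} eq = ⊥-elim (S∩P'=∅ (v⊆S j) (F⊆P' a i) (≡.sym eq))
    injective′ {suc a , i} {suc b , j} eq with refl ← injective {a , i} {b , j} eq = refl
    F′⊆P : ∀ a j → (v ∷ᶠ F) a j ∈ P
    F′⊆P zero j = ∈-resp-↭ (↭-sym P↭) (∈-++⁺ˡ (v⊆S j))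
    F′⊆P (suc a) j = ∈-resp-↭ (↭-sym P↭) (∈-++⁺ʳ S (F⊆P' a j))

  MonoClique⇒K₄-packing : ∀ {c} b P → MonoClique c P → b * 4 ≤ length P → Packing c 4 b P
  MonoClique⇒K₄-packing zero P _ _ = Packing-[]
  MonoClique⇒K₄-packing (suc b) (q₁ ∷ q₂ ∷ q₃ ∷ q₄ ∷ P) clique (s≤s (s≤s (s≤s (s≤s 4b≤∣P∣)))) =
    Packing-∷ (MonoClique⇒Unique clique) ↭-refl (MonoClique⇒MonoCopy (take⁺ 4 clique)) ∈-lookup
      (MonoClique⇒K₄-packing b P (drop⁺ 4 clique) 4b≤∣P∣)

  record BlueK₄AndRedEdge (S : List (Fin n)) : Set where
    field
      distinct : Unique S
      size : length S ≡ 5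
      K₄ : Fin 4 → Fin n
      K₄-blue : MonoCopy G blue 4 K₄
      K₄⊆S : ∀ j → K₄ j ∈ S
      edge : Fin 2 → Fin n
      edge-red : MonoCopy G red 2 edge
      edge⊆S : ∀ j → edge j ∈ S

  fan⇒BlueK₄AndRedEdge : ∀ {w q₁ q₂ q₃ q₄ q} → let Q = q₁ ∷ q₂ ∷ q₃ ∷ q₄ ∷ [] in
            All (w ≢_) Q → MonoClique blue Q → q ∈ Q → col G w q ≡ red → BlueK₄AndRedEdge (w ∷ Q)
  fan⇒BlueK₄AndRedEdge {w} {q₁} {q₂} {q₃} {q₄} {q} w∉Q Q-blue q∈Q wq = record
    { distinct = w∉Q ∷ MonoClique⇒Unique Q-blue
    ; size = refl
    ; K₄ = lookup (q₁ ∷ q₂ ∷ q₃ ∷ q₄ ∷ [])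
    ; K₄-blue = MonoClique⇒MonoCopy Q-blue
    ; K₄⊆S = there ∘ ∈-lookup
    ; edge = lookup (w ∷ q ∷ [])
    ; edge-red = MonoClique⇒MonoCopy (Mono⇒MonoClique (All.lookup w∉Q q∈Q , wq))
    ; edge⊆S = λ { zero → here refl ; (suc zero) → there q∈Q }
    }

  red-edge+blue-K₄ : ∀ {x y q₁ q₂ q₃ q₄ P} → let Q = q₁ ∷ q₂ ∷ q₃ ∷ q₄ ∷ [] in
                     Mono red x y → MonoClique blue Q → All (_∈ P) Q → Unique (x ∷ y ∷ P) →
                     ∃ λ S → All (_∈ x ∷ y ∷ P) S × BlueK₄AndRedEdge S
  red-edge+blue-K₄ {x} {y} {q₁} {q₂} {q₃} {q₄} xy Q-blue Q⊆P ((_ ∷ x∉P) ∷ y∉P ∷ _)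
    with blue-or-red-edge x (q₁ ∷ q₂ ∷ q₃ ∷ q₄ ∷ [])
  ... | inj₂ (q , q∈Q , xq) =
    _ , here refl ∷ All.map (there ∘ there) Q⊆P ,
    fan⇒BlueK₄AndRedEdge (All.map (All.lookup x∉P) Q⊆P) Q-blue q∈Q xq
  ... | inj₁ (_ ∷ xq₂₃₄-blue) with _ ∷ q₂₃₄-blue ← Q-blue | _ ∷ q₂₃₄⊆P ← Q⊆P =
    _ , there (here refl) ∷ here refl ∷ All.map (there ∘ there) q₂₃₄⊆P ,
    fan⇒BlueK₄AndRedEdge (proj₁ yx ∷ All.map (All.lookup y∉P) q₂₃₄⊆P)
      (All.zip (All.map (All.lookup x∉P) q₂₃₄⊆P , xq₂₃₄-blue) ∷ q₂₃₄-blue) (here refl) (proj₂ yx)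
    where
    yx = Mono-sym xy

  red-matching-or-blue-K₄s : ∀ a b P → Unique P → Large a b (length P) →
                             Packing red 2 a P ⊎ Packing blue 4 b P
  red-matching-or-blue-K₄ : ∀ a P → Unique P → 2 * a + 3 ≤ suc (length P) →
                            Packing red 2 a P ⊎ Packing blue 4 1 P
  red-edge⇒red-matching-or-blue-K₄s : ∀ {x y} a b P → Unique P → Large (suc a) (suc b) (length P) →
    x ∈ P → y ∈ P → Mono red x y → Packing red 2 (suc a) P ⊎ Packing blue 4 (suc b) P
  BlueK₄AndRedEdge⇒red-matching-or-blue-K₄s : ∀ {S} a b P → Unique P → Large (suc a) (suc b) (length P) →
    All (_∈ P) S → BlueK₄AndRedEdge S → Packing red 2 (suc a) P ⊎ Packing blue 4 (suc b) P

  red-matching-or-blue-K₄s zero b P _ _ = inj₁ Packing-[]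
  red-matching-or-blue-K₄s (suc a) zero P _ _ = inj₂ Packing-[]
  red-matching-or-blue-K₄s (suc a) (suc b) P uP large with red-edge-or-blue-clique P uP
  ... | inj₁ (x , y , x∈P , y∈P , xy) = red-edge⇒red-matching-or-blue-K₄s a b P uP large x∈P y∈P xy
  ... | inj₂ P-blue = inj₂ (MonoClique⇒K₄-packing (suc b) P P-blue (Large⇒K₄-room large))

  red-matching-or-blue-K₄ zero P _ _ = inj₁ Packing-[]
  red-matching-or-blue-K₄ (suc a) P uP room =
    red-matching-or-blue-K₄s (suc a) 1 P uP (matching-room⇒Large room)

  red-edge⇒red-matching-or-blue-K₄s a b P uP large x∈P y∈P xy
    with P₁ , P↭ ← ↭-complement (MonoClique⇒Unique (Mono⇒MonoClique xy)) (x∈P ∷ y∈P ∷ [])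
    with red-matching-or-blue-K₄ a P₁ (complement-Unique uP P↭)
           (Large⇒matching-room (subst (Large (suc a) (suc b)) (↭-length P↭) large))
  ... | inj₁ M = inj₁ (Packing-∷ uP P↭ (MonoClique⇒MonoCopy (Mono⇒MonoClique xy)) ∈-lookup M)
  ... | inj₂ ((K , K-blue , _) , K⊆P₁)
    with S , S⊆xyP₁ , gadget ← red-edge+blue-K₄ xy (MonoCopy⇒MonoClique (K-blue zero))
                                  (All-tabulate⁺ (K⊆P₁ zero)) (Unique-↭ P↭ uP)
    = BlueK₄AndRedEdge⇒red-matching-or-blue-K₄s a b P uP large
        (All.map (∈-resp-↭ (↭-sym P↭)) S⊆xyP₁) gadget

  BlueK₄AndRedEdge⇒red-matching-or-blue-K₄s {S} a b P uP large S⊆P gadget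
    with P₂ , P↭ ← ↭-complement (BlueK₄AndRedEdge.distinct gadget) S⊆P =
    Sum.map (Packing-∷ uP P↭ edge-red edge⊆S) (Packing-∷ uP P↭ K₄-blue K₄⊆S)
      (red-matching-or-blue-K₄s a b P₂ (complement-Unique uP P↭) (Large-shrink large′))
    where
    open BlueK₄AndRedEdge gadget
    large′ : Large (suc a) (suc b) (5 + length P₂)
    large′ = subst (Large (suc a) (suc b))
                   (≡.trans (complement-length {S = S} P↭) (cong (_+ length P₂) size)) large

≤-by : ∀ {m n} d → m + d ≡ n → m ≤ n
≤-by {m} d eq = subst (m ≤_) eq (m≤m+n m d)

Large-middle : ∀ k u → 3 < u → u ≤ k + 3 → Large (u ∸ 3) (suc k) (4 * k + u)
Large-middle k u 3<u u≤k+3 with t , refl ← m≤n⇒∃[o]m+o≡n 3<u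
  with s , refl ← m≤n⇒∃[o]m+o≡n (+-cancelˡ-≤ 3 (suc t) k (subst (4 + t ≤_) (+-comm k 3) u≤k+3)) =
  ≤-by (suc s) (slack₁ t s) , ≤-by 0 (slack₂ t s)
  where
  slack₁ : ∀ t s → 2 * suc t + 3 * suc (suc t + s) + suc s ≡ suc (4 * (suc t + s) + (4 + t))
  slack₁ = solve-∀
  slack₂ : ∀ t s → suc t + 4 * suc (suc t + s) + 0 ≡ suc (4 * (suc t + s) + (4 + t))
  slack₂ = solve-∀

Large-top : ∀ k u → k + 3 < u → Large ((u + k ∸ 2) / 2) (suc k) (4 * k + u)
Large-top k u k+3<u with t , refl ← m≤n⇒∃[o]m+o≡n k+3<u =
  subst (λ m → Large (m / 2) (suc k) (4 * k + (suc (k + 3) + t))) (cong (_∸ 2) (regroup k t)) (h₁ , h₂)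
  where
  m = 2 * suc k + t
  2[m/2]≤m : 2 * (m / 2) ≤ m
  2[m/2]≤m = subst (_≤ m) (*-comm (m / 2) 2) (m/n*n≤m m 2)
  h₁ : 2 * (m / 2) + 3 * suc k ≤ suc (4 * k + (suc (k + 3) + t))
  h₁ = subst (2 * (m / 2) + 3 * suc k ≤_) (slack₁ k t) (+-monoˡ-≤ (3 * suc k) 2[m/2]≤m)
    where
    slack₁ : ∀ k t → 2 * suc k + t + 3 * suc k ≡ suc (4 * k + (suc (k + 3) + t))
    slack₁ = solve-∀
  m/2≤1+k+t : m / 2 ≤ suc k + t
  m/2≤1+k+t = *-cancelʳ-≤ (m / 2) (suc k + t) 2 (≤-trans (m/n*n≤m m 2) (≤-by t (slack₂ k t)))
    where
    slack₂ : ∀ k t → 2 * suc k + t + t ≡ (suc k + t) * 2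
    slack₂ = solve-∀
  h₂ : m / 2 + 4 * suc k ≤ suc (4 * k + (suc (k + 3) + t))
  h₂ = subst (m / 2 + 4 * suc k ≤_) (slack₃ k t) (+-monoˡ-≤ (4 * suc k) m/2≤1+k+t)
    where
    slack₃ : ∀ k t → suc k + t + 4 * suc k ≡ suc (4 * k + (suc (k + 3) + t))
    slack₃ = solve-∀
  regroup : ∀ k t → 2 + (2 * suc k + t) ≡ suc (k + 3) + t + k
  regroup = solve-∀

f-Large : ∀ k u → f k u ≡ 0 ⊎ Large (f k u) (suc k) (4 * k + u)
f-Large k u with u ≤? 3
... | yes _ = inj₁ refl
... | no u≰3 with u ≤? k + 3
...   | yes u≤k+3 = inj₂ (Large-middle k u (≰⇒> u≰3) u≤k+3)
...   | no u≰k+3 = inj₂ (Large-top k u (≰⇒> u≰k+3))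

lemma2p3 : (k u : ℕ) → k ≥ 1 → (G : Colouring (4 * k + u)) →
    (∀ m → DisjointCopies G blue 4 m → m ≤ k) →
    DisjointCopies G red 2 (f k u)
lemma2p3 k u _ G at-most-k with f-Large k u
... | inj₁ f≡0 = subst (DisjointCopies G red 2) (≡.sym f≡0) (proj₁ (Packing-[] G {P = []}))
... | inj₂ large
  with red-matching-or-blue-K₄s G (f k u) (suc k) (allFin _) (allFin⁺ _)
         (subst (Large (f k u) (suc k)) (≡.sym (length-tabulate id)) large)
...   | inj₁ matching = proj₁ matching
...   | inj₂ K₄s = ⊥-elim (1+n≰n (at-most-k (suc k) (proj₁ K₄s)))
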